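{- Let $N\equiv3\pmod4$ be a prime and let $h_1,h_2,c_1,c_2,c_4\in\mathbb Z$ with $4c_1c_4-c_2^2\not\equiv0\pmod N$. Let $a,b$ be integers coprime to $N$, and let $L(c_1,c_2,c_4,h_1,h_2)$ be the number of triples $d_1,d_2,d_4\pmod N$ satisfying $$h_1\equiv a(d_1+d_4),\qquad (d_1d_4-d_2^2)h_2\equiv b(d_4c_1-d_2c_2+d_1c_4),\qquad d_1d_4-d_2^2\not\equiv0 \pmod N.$$ Then $$L(c_1,c_2,c_4,h_1,h_2)=\delta_{h_1\equiv h_2\equiv 0\,(N)}\,\delta_{c_1\equiv c_4,\ c_2\equiv0\,(N)}\,N^2+O(N),$$ where $\delta_{\mathcal P}$ equals $1$ if condition $\mathcal P$ holds and $0$ otherwise, and the implied constant is absolute. -}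

module Defs where

open import Data.Nat as ℕ using (ℕ)
open import Data.Nat.Divisibility as ℕD using (_∣?_)
open import Data.Integer using (ℤ; +_; _-_; _*_; ∣_∣)
open import Data.Fin using (Fin; toℕ)
open import Data.List using (List; length; filter; allFin; cartesianProduct; map)
open import Data.Product using (_×_; _,_)
open import Relation.Nullary using (Dec; yes; no; ¬_; _×-dec_; ¬?)

infix 4 _≡_[mod_] _≡?_[mod_]

_≡_[mod_] : ℤ → ℤ → ℕ → Set
x ≡ y [mod N ] = N ℕD.∣ ∣ x - y ∣

_≡?_[mod_] : (x y : ℤ) (N : ℕ) → Dec (x ≡ y [mod N ])
x ≡? y [mod N ] = N ∣? ∣ x - y ∣

δ : {P : Set} → Dec P → ℕ
δ (yes _) = 1
δ (no _)  = 0

Cond : (N : ℕ) (a b c₁ c₂ c₄ h₁ h₂ : ℤ) → ℤ × ℤ × ℤ → Set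
Cond N a b c₁ c₂ c₄ h₁ h₂ (d₁ , d₂ , d₄) =
  (h₁ ≡ a * (d₁ Data.Integer.+ d₄) [mod N ]) ×
  ((((d₁ * d₄) - (d₂ * d₂)) * h₂) ≡ b * (((d₄ * c₁) - (d₂ * c₂)) Data.Integer.+ (d₁ * c₄)) [mod N ]) ×
  (¬ ((d₁ * d₄) - (d₂ * d₂) ≡ + 0 [mod N ]))

cond? : (N : ℕ) (a b c₁ c₂ c₄ h₁ h₂ : ℤ) (t : ℤ × ℤ × ℤ) → Dec (Cond N a b c₁ c₂ c₄ h₁ h₂ t)
cond? N a b c₁ c₂ c₄ h₁ h₂ (d₁ , d₂ , d₄) =
  (h₁ ≡? a * (d₁ Data.Integer.+ d₄) [mod N ]) ×-dec
  ((((d₁ * d₄) - (d₂ * d₂)) * h₂) ≡? b * (((d₄ * c₁) - (d₂ * c₂)) Data.Integer.+ (d₁ * c₄)) [mod N ]) ×-dec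
  ¬? ((d₁ * d₄) - (d₂ * d₂) ≡? + 0 [mod N ])

residues : (N : ℕ) → List ℤ
residues N = map (λ (i : Fin N) → + toℕ i) (allFin N)

triples : (N : ℕ) → List (ℤ × ℤ × ℤ)
triples N = cartesianProduct (residues N) (cartesianProduct (residues N) (residues N))

L : (N : ℕ) (a b c₁ c₂ c₄ h₁ h₂ : ℤ) → ℕ
L N a b c₁ c₂ c₄ h₁ h₂ = length (filter (cond? N a b c₁ c₂ c₄ h₁ h₂) (triples N))

module Submission where

-- Write L as a sum of slices over d₁.  As a is a unit, the linear congruence
-- fixes d₄ once d₁ is given, so the slice of d₁ counts the d₂ admissible for d₁.
--  * If h₂ or c₂ is nonzero mod N, the admissible d₂ are the roots of a
--    quadratic that does not vanish identically: every slice has ≤ 2 elements.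
--  * If h₂ ≡ c₂ ≡ 0 but c₁ ≢ c₄, all solutions share the same d₁: L ≤ N.
--  * If h₂ ≡ c₂ ≡ 0 and c₁ ≡ c₄ but h₁ ≢ 0, there is no solution at all.
--  * In the main case h₁ ≡ h₂ ≡ c₂ ≡ 0, c₁ ≡ c₄ the conditions say d₄ ≡ -d₁ and
--    d₁² + d₂² ≢ 0, so N - 2 ≤ slice ≤ N and |L - N²| ≤ 2N.

open import Defs
open import Data.Nat as ℕ using (ℕ; _%_; _≤_; _^_)
open import Data.Nat.Primality using (Prime)
open import Data.Integer as ℤ using (ℤ; +_; ∣_∣; _-_)
open import Data.Integer.Coprimality using (Coprime)
open import Data.Product using (∃-syntax; _×_; _,_)
open import Relation.Nullary using (¬_; _×-dec_)
open import Relation.Binary.PropositionalEquality using (_≡_; sym; trans; subst)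
import Data.Nat.Properties as ℕ
import Data.Integer.Properties as ℤ
open import Data.Sum using (inj₁; inj₂)

module Counting where
  open import Level using (0ℓ)
  open import Function using (_∘_)
  open import Data.Nat using (ℕ; suc; _+_; _*_; _≤_; z≤n; s≤s)
  open import Data.Nat.Properties
    using (+-suc; +-mono-≤; ≤-antisym; ≤-trans; ≤-reflexive; +-commutativeSemigroup)
  open import Data.Nat.ListAction using (sum)
  open import Algebra.Properties.CommutativeSemigroup +-commutativeSemigroup
    using (interchange)
  open import Data.List using (List; []; _∷_; _++_; length; filter; map; cartesianProduct)
  open import Data.List.Properties using (filter-++; length-++; filter-none; filter-some)
  open import Data.List.Relation.Unary.Any using (Any; any?)
  open import Data.List.Relation.Unary.All using (All; []; _∷_)
  open import Data.List.Relation.Unary.All.Properties using (¬Any⇒All¬; all-filter)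
  open import Data.List.Relation.Unary.AllPairs using (AllPairs; []; _∷_)
  import Data.List.Relation.Unary.AllPairs.Properties as AllPairs
  open import Data.Product using (_×_; _,_)
  open import Data.Empty using (⊥; ⊥-elim)
  open import Relation.Nullary using (¬_; yes; no; ¬?)
  open import Relation.Unary using (Pred; Decidable)
  open import Relation.Binary.PropositionalEquality
    using (_≡_; refl; cong; cong₂; trans; module ≡-Reasoning)

  private variable
    A B : Set

  count : {P : Pred A 0ℓ} → Decidable P → List A → ℕ
  count P? xs = length (filter P? xs)

  module _ {P : Pred A 0ℓ} (P? : Decidable P) where

    count-split : ∀ xs → count P? xs + count (¬? ∘ P?) xs ≡ length xs
    count-split [] = refl
    count-split (x ∷ xs) with P? x
    ... | yes _ = cong suc (count-split xs)
    ... | no _  = trans (+-suc _ _) (cong suc (count-split xs))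

    count-none : ∀ {xs} → ¬ Any P xs → count P? xs ≡ 0
    count-none {xs} none = cong length (filter-none P? (¬Any⇒All¬ xs none))

    count-map : ∀ (f : B → A) ys → count P? (map f ys) ≡ count (P? ∘ f) ys
    count-map f [] = refl
    count-map f (y ∷ ys) with P? (f y)
    ... | yes _ = cong suc (count-map f ys)
    ... | no _  = count-map f ys

    count-≤1 : ∀ {R : A → A → Set} {xs} → AllPairs R xs →
               (∀ {x y} → P x → P y → R x y → ⊥) → count P? xs ≤ 1
    count-≤1 {xs = xs} separated clash =
      at-most-one (AllPairs.filter⁺ P? separated) (all-filter P? xs)
      where
      at-most-one : ∀ {ys} → AllPairs _ ys → All P ys → length ys ≤ 1
      at-most-one [] _ = z≤n
      at-most-one (_ ∷ []) _ = s≤s z≤n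
      at-most-one ((rxy ∷ _) ∷ _) (px ∷ py ∷ _) = ⊥-elim (clash px py rxy)

    count-≤2 : ∀ {R : A → A → Set} {xs} → AllPairs R xs →
               (∀ {x y z} → P x → P y → P z → R x y → R x z → R y z → ⊥) →
               count P? xs ≤ 2
    count-≤2 {xs = xs} separated clash =
      at-most-two (AllPairs.filter⁺ P? separated) (all-filter P? xs)
      where
      at-most-two : ∀ {ys} → AllPairs _ ys → All P ys → length ys ≤ 2
      at-most-two [] _ = z≤n
      at-most-two (_ ∷ []) _ = s≤s z≤n
      at-most-two (_ ∷ _ ∷ []) _ = s≤s (s≤s z≤n)
      at-most-two ((rxy ∷ rxz ∷ _) ∷ (ryz ∷ _) ∷ _) (px ∷ py ∷ pz ∷ _) =
        ⊥-elim (clash px py pz rxy rxz ryz)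

    sum-≤-support : ∀ (f : A → ℕ) {k} xs → (∀ x → f x ≤ k) →
                    (∀ x → ¬ P x → f x ≡ 0) → sum (map f xs) ≤ count P? xs * k
    sum-≤-support f [] _ _ = z≤n
    sum-≤-support f (x ∷ xs) ≤k off with P? x
    ... | yes _  = +-mono-≤ (≤k x) (sum-≤-support f xs ≤k off)
    ... | no ¬px = ≤-trans (≤-reflexive (cong (_+ sum (map f xs)) (off x ¬px)))
                           (sum-≤-support f xs ≤k off)

  count-product : {P : Pred (A × B) 0ℓ} (P? : Decidable P) → ∀ xs ys →
    count P? (cartesianProduct xs ys) ≡ sum (map (λ x → count (λ y → P? (x , y)) ys) xs)
  count-product P? [] ys = refl
  count-product P? (x ∷ xs) ys = begin
    length (filter P? (map (x ,_) ys ++ cartesianProduct xs ys))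
      ≡⟨ cong length (filter-++ P? (map (x ,_) ys) _) ⟩
    length (filter P? (map (x ,_) ys) ++ filter P? (cartesianProduct xs ys))
      ≡⟨ length-++ (filter P? (map (x ,_) ys)) ⟩
    count P? (map (x ,_) ys) + count P? (cartesianProduct xs ys)
      ≡⟨ cong₂ _+_ (count-map P? (x ,_) ys) (count-product P? xs ys) ⟩
    count (λ y → P? (x , y)) ys + sum (map (λ x → count (λ y → P? (x , y)) ys) xs) ∎
    where open ≡-Reasoning

  sum-fibres≤1 : {Q : A → Pred B 0ℓ} (Q? : ∀ x → Decidable (Q x)) → ∀ ys xs →
    (∀ x → count (Q? x) ys ≤ 1) →
    sum (map (λ x → count (Q? x) ys) xs) ≡ count (λ x → any? (Q? x) ys) xs
  sum-fibres≤1 Q? ys [] _ = refl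
  sum-fibres≤1 Q? ys (x ∷ xs) ≤1 with any? (Q? x) ys
  ... | yes some = cong₂ _+_ (≤-antisym (≤1 x) (filter-some (Q? x) some))
                             (sum-fibres≤1 Q? ys xs ≤1)
  ... | no none  = cong₂ _+_ (count-none (Q? x) none) (sum-fibres≤1 Q? ys xs ≤1)

  sum-≤ : ∀ (f : A → ℕ) {k} xs → (∀ x → f x ≤ k) → sum (map f xs) ≤ length xs * k
  sum-≤ f [] _ = z≤n
  sum-≤ f (x ∷ xs) ≤k = +-mono-≤ (≤k x) (sum-≤ f xs ≤k)

  sum-≥ : ∀ (f : A → ℕ) {k e} xs → (∀ x → k ≤ f x + e) →
          length xs * k ≤ sum (map f xs) + length xs * e
  sum-≥ f [] _ = z≤n
  sum-≥ f {k} {e} (x ∷ xs) ≥k = ≤-trans (+-mono-≤ (≥k x) (sum-≥ f xs ≥k))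
                                        (≤-reflexive (interchange (f x) e _ _))

module ModPrime (N : ℕ) (N-prime : Prime N) where
  open import Data.Nat as ℕ using (_<_; _≤_)
  import Data.Nat.Properties as ℕ
  import Data.Nat.Divisibility as ℕ
  open import Data.Nat.DivMod using (m<n⇒m%n≡m)
  open import Data.Nat.Primality using (euclidsLemma; prime⇒nonZero; prime⇒nonTrivial)
  open import Data.Integer using (ℤ; +_; -_; _+_; _-_; _*_; ∣_∣; _⊖_)
  import Data.Integer.Properties as ℤ
  open import Data.Integer.DivMod using (_%ℕ_; _/ℕ_; a≡a%ℕn+[a/ℕn]*n; n%ℕd<d)
  open import Data.Integer.Divisibility.Signed
    using (_∣_; ∣ᵤ⇒∣; ∣⇒∣ᵤ; ∣m∣n⇒∣m+n; ∣m∣n⇒∣m-n; ∣n⇒∣m*n; ∣-refl)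
  open import Data.Integer.Coprimality using (Coprime; coprime-divisor)
  import Data.Integer.Coprimality as Coprime
  open import Data.Integer.Tactic.RingSolver using (solve-∀)
  open import Data.Fin using (Fin; toℕ; fromℕ<)
  open import Data.Fin.Properties using (toℕ<n; toℕ-injective; toℕ-fromℕ<)
  open import Data.List using (length; allFin)
  open import Data.List.Properties using (length-map; length-tabulate)
  open import Data.List.Membership.Propositional using (_∈_)
  open import Data.List.Membership.Propositional.Properties using (∈-map⁺; ∈-allFin)
  open import Data.List.Relation.Unary.AllPairs using (AllPairs)
  import Data.List.Relation.Unary.AllPairs.Properties as AllPairs
  open import Data.Product using (_×_; _,_; ∃-syntax)
  open import Data.Sum using (_⊎_; inj₁; inj₂; [_,_]′)
  open import Data.Empty using (⊥-elim)
  open import Relation.Nullary using (¬_)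
  open import Level using (0ℓ)
  open import Relation.Unary using (Pred; Decidable)
  open import Relation.Binary.PropositionalEquality
    using (_≡_; _≢_; sym; trans; cong; subst)
  open Counting using (count; count-≤2)

  instance
    N-nonZero : ℕ.NonZero N
    N-nonZero = prime⇒nonZero N-prime

  N∣_ : ℤ → Set
  N∣ x = + N ∣ x

  mod⇒N∣ : ∀ {x y} → x ≡ y [mod N ] → N∣ (x - y)
  mod⇒N∣ = ∣ᵤ⇒∣

  N∣⇒mod : ∀ {x y} → N∣ (x - y) → x ≡ y [mod N ]
  N∣⇒mod = ∣⇒∣ᵤ

  euclid : ∀ x y → N∣ (x * y) → N∣ x ⊎ N∣ y
  euclid x y N∣xy with euclidsLemma ∣ x ∣ ∣ y ∣ N-prime
                         (subst (N ℕ.∣_) (ℤ.abs-* x y) (∣⇒∣ᵤ N∣xy))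
  ... | inj₁ N∣x = inj₁ (∣ᵤ⇒∣ N∣x)
  ... | inj₂ N∣y = inj₂ (∣ᵤ⇒∣ N∣y)

  cancel-nonzero : ∀ x y → ¬ N∣ x → N∣ (x * y) → N∣ y
  cancel-nonzero x y N∤x N∣xy =
    [ (λ N∣x → ⊥-elim (N∤x N∣x)) , (λ N∣y → N∣y) ]′ (euclid x y N∣xy)

  cancel-unit : ∀ a x → Coprime a (+ N) → N∣ (a * x) → N∣ x
  cancel-unit a x a⊥N N∣ax =
    ∣ᵤ⇒∣ (coprime-divisor (+ N) a x (Coprime.sym {a} {+ N} a⊥N) (∣⇒∣ᵤ N∣ax))

  N∤-1 : ¬ N∣ (- + 1)
  N∤-1 N∣-1 = ℕ.nonTrivial⇒≢1 {{prime⇒nonTrivial N-prime}} (ℕ.∣1⇒≡1 (∣⇒∣ᵤ N∣-1))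

  Incongruent : ℤ → ℤ → Set
  Incongruent x y = ¬ N∣ (x - y)

  quadratic : ℤ → ℤ → ℤ → ℤ → ℤ
  quadratic α β γ x = α * x * x + β * x + γ

  three-roots : ∀ α β γ {r s u} → Incongruent r s → Incongruent r u → Incongruent s u →
                N∣ quadratic α β γ r → N∣ quadratic α β γ s → N∣ quadratic α β γ u →
                N∣ α × N∣ β × N∣ γ
  three-roots α β γ {r} {s} {u} r≢s r≢u s≢u qr qs qu = N∣α , N∣β , N∣γ
    where
    -- the difference quotient α (r + t) + β vanishes for every root t ≢ r
    difference : ∀ α β γ r t → (α * r * r + β * r + γ) - (α * t * t + β * t + γ)
                                ≡ (r - t) * (α * (r + t) + β)
    difference = solve-∀
    slope : ∀ t → Incongruent r t → N∣ quadratic α β γ t → N∣ (α * (r + t) + β)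
    slope t r≢t qt = cancel-nonzero (r - t) (α * (r + t) + β) r≢t
                       (subst N∣_ (difference α β γ r t) (∣m∣n⇒∣m-n qr qt))
    slope-difference : ∀ α β r s u → (α * (r + s) + β) - (α * (r + u) + β) ≡ (s - u) * α
    slope-difference = solve-∀
    N∣α : N∣ α
    N∣α = cancel-nonzero (s - u) α s≢u (subst N∣_ (slope-difference α β r s u)
                                          (∣m∣n⇒∣m-n (slope s r≢s qs) (slope u r≢u qu)))
    β-from-slope : ∀ α β r s → (α * (r + s) + β) - (r + s) * α ≡ β
    β-from-slope = solve-∀
    N∣β : N∣ β
    N∣β = subst N∣_ (β-from-slope α β r s)
            (∣m∣n⇒∣m-n (slope s r≢s qs) (∣n⇒∣m*n (r + s) N∣α))
    γ-from-value : ∀ α β γ r → (α * r * r + β * r + γ) - ((r * r) * α + r * β) ≡ γ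
    γ-from-value = solve-∀
    N∣γ : N∣ γ
    N∣γ = subst N∣_ (γ-from-value α β γ r)
            (∣m∣n⇒∣m-n qr (∣m∣n⇒∣m+n (∣n⇒∣m*n (r * r) N∣α) (∣n⇒∣m*n r N∣β)))

  roots≤2 : ∀ {P : Pred ℤ 0ℓ} (P? : Decidable P) α β γ {xs} → AllPairs Incongruent xs →
            ¬ (N∣ α × N∣ β × N∣ γ) → (∀ {x} → P x → N∣ quadratic α β γ x) →
            count P? xs ≤ 2
  roots≤2 P? α β γ incongruent nonzero root = count-≤2 P? incongruent
    λ px py pz x≢y x≢z y≢z →
      nonzero (three-roots α β γ x≢y x≢z y≢z (root px) (root py) (root pz))

  congruent-below-N : ∀ {m n} → m < N → n < N → N∣ (+ m - + n) → m ≡ n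
  congruent-below-N {m} {n} m<N n<N N∣m-n =
    ℤ.+-injective (ℤ.i-j≡0⇒i≡j (+ m) (+ n)
      (trans (ℤ.[+m]-[+n]≡m⊖n m n) (ℤ.∣i∣≡0⇒i≡0 ∣m⊖n∣≡0)))
    where
    ∣m⊖n∣<N : ∣ m ⊖ n ∣ < N
    ∣m⊖n∣<N = ℕ.≤-<-trans (ℤ.∣m⊝n∣≤m⊔n m n) (ℕ.⊔-pres-<m m<N n<N)
    N∣∣m⊖n∣ : N ℕ.∣ ∣ m ⊖ n ∣
    N∣∣m⊖n∣ = subst (N ℕ.∣_) (cong ∣_∣ (ℤ.[+m]-[+n]≡m⊖n m n)) (∣⇒∣ᵤ N∣m-n)
    ∣m⊖n∣≡0 : ∣ m ⊖ n ∣ ≡ 0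
    ∣m⊖n∣≡0 = trans (sym (m<n⇒m%n≡m ∣m⊖n∣<N)) (ℕ.n∣m⇒m%n≡0 _ N N∣∣m⊖n∣)

  residues-length : length (residues N) ≡ N
  residues-length = trans (length-map _ (allFin N)) (length-tabulate _)

  residues-incongruent : AllPairs Incongruent (residues N)
  residues-incongruent = AllPairs.map⁺ (AllPairs.tabulate⁺ {f = λ i → i} distinct)
    where
    distinct : ∀ {i j : Fin N} → i ≢ j → Incongruent (+ toℕ i) (+ toℕ j)
    distinct i≢j N∣i-j = i≢j (toℕ-injective (congruent-below-N (toℕ<n _) (toℕ<n _) N∣i-j))

  residue-of : ∀ x → ∃[ r ] r ∈ residues N × N∣ (r - x)
  residue-of x =
    + (x %ℕ N) , member , subst N∣_ (sym remainder) (∣n⇒∣m*n (- (x /ℕ N)) ∣-refl)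
    where
    shift : ∀ r q n → r - (r + q * n) ≡ - q * n
    shift = solve-∀
    remainder : + (x %ℕ N) - x ≡ - (x /ℕ N) * + N
    remainder = trans (cong (λ y → + (x %ℕ N) - y) (a≡a%ℕn+[a/ℕn]*n x N))
                      (shift (+ (x %ℕ N)) (x /ℕ N) (+ N))
    member : + (x %ℕ N) ∈ residues N
    member = subst (λ k → + k ∈ residues N) (toℕ-fromℕ< (n%ℕd<d x N))
                   (∈-map⁺ (λ i → + toℕ i) (∈-allFin (fromℕ< (n%ℕd<d x N))))

distance-≤ : ∀ m n k → m ≤ n ℕ.+ k → n ≤ m ℕ.+ k → ∣ + m - + n ∣ ≤ k
distance-≤ m n k m≤n+k n≤m+k rewrite ℤ.[+m]-[+n]≡m⊖n m n with ℕ.≤-total m n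
... | inj₁ m≤n = subst (_≤ k) (sym (ℤ.∣⊖∣-≤ m≤n)) (ℕ.m≤n+o⇒m∸n≤o n m n≤m+k)
... | inj₂ n≤m = subst (_≤ k) (sym (trans (ℤ.∣m⊖n∣≡∣n⊖m∣ m n) (ℤ.∣⊖∣-≤ n≤m)))
                         (ℕ.m≤n+o⇒m∸n≤o m n m≤n+k)

module TripleCount (N : ℕ) (N-prime : Prime N) (a b c₁ c₂ c₄ h₁ h₂ : ℤ)
                   (a⊥N : Coprime a (+ N)) (b⊥N : Coprime b (+ N)) where
  open import Function using (_∘_)
  open import Data.Nat using (_*_; z≤n)
  open import Data.Nat.Properties
    using (≤-trans; m≤m*n; m≤m+n; +-monoʳ-≤; *-monoˡ-≤; *-identityˡ; *-identityʳ; *-comm;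
           module ≤-Reasoning)
  open import Data.Nat.ListAction using (sum)
  open import Data.Integer using (-_; _+_) renaming (_*_ to _·_)
  import Data.Integer.Properties as ℤ
  open import Data.Integer.Divisibility.Signed
    using (_∣?_; ∣m∣n⇒∣m+n; ∣m∣n⇒∣m-n; ∣n⇒∣m*n; ∣m⇒∣m*n; ∣m⇒∣-m; ∣m+n∣n⇒∣m)
  open import Data.Integer.Tactic.RingSolver using (solve-∀)
  open import Data.List using (List; map; cartesianProduct)
  open import Data.List.Properties using (length-filter)
  open import Data.List.Membership.Propositional using (_∈_; lose)
  open import Data.List.Relation.Unary.Any using (Any; any?; satisfied)
  open import Data.Product using (_,_; proj₁; proj₂)
  open import Data.Sum using (_⊎_; inj₁; inj₂; [_,_]′)
  open import Data.Empty using (⊥)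
  open import Relation.Nullary using (yes; no; ¬?)
  open import Relation.Nullary.Decidable using (decidable-stable)
  open import Relation.Unary using (Decidable)
  open import Relation.Binary.PropositionalEquality using (sym; trans; cong; subst; subst₂)
  open Counting
  open ModPrime N N-prime

  R : List ℤ
  R = residues N

  Solution : ℤ × ℤ × ℤ → Set
  Solution = Cond N a b c₁ c₂ c₄ h₁ h₂

  solution? : Decidable Solution
  solution? = cond? N a b c₁ c₂ c₄ h₁ h₂

  #solutions : ℕ
  #solutions = L N a b c₁ c₂ c₄ h₁ h₂

  ≡0⇒N∣ : ∀ {x} → x ≡ + 0 [mod N ] → N∣ x
  ≡0⇒N∣ {x} x≡0 = subst N∣_ (ℤ.+-identityʳ x) (mod⇒N∣ {x} {+ 0} x≡0)

  N∣⇒≡0 : ∀ {x} → N∣ x → x ≡ + 0 [mod N ]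
  N∣⇒≡0 {x} N∣x = N∣⇒mod {x} {+ 0} (subst N∣_ (sym (ℤ.+-identityʳ x)) N∣x)

  linear : ∀ d₁ d₂ d₄ → Solution (d₁ , d₂ , d₄) → N∣ (h₁ - a · (d₁ + d₄))
  linear d₁ _ d₄ (lin , _ , _) = mod⇒N∣ {h₁} {a · (d₁ + d₄)} lin

  quadric : ∀ d₁ d₂ d₄ → Solution (d₁ , d₂ , d₄) →
            N∣ ((d₁ · d₄ - d₂ · d₂) · h₂ - b · (d₄ · c₁ - d₂ · c₂ + d₁ · c₄))
  quadric d₁ d₂ d₄ (_ , quad , _) =
    mod⇒N∣ {(d₁ · d₄ - d₂ · d₂) · h₂} {b · (d₄ · c₁ - d₂ · c₂ + d₁ · c₄)} quad

  trace-unique : ∀ u v → N∣ (h₁ - a · u) → N∣ (h₁ - a · v) → N∣ (u - v)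
  trace-unique u v N∣u N∣v =
    cancel-unit a (u - v) a⊥N (subst N∣_ (difference h₁ a u v) (∣m∣n⇒∣m-n N∣v N∣u))
    where
    difference : ∀ h a u v → (h - a · v) - (h - a · u) ≡ a · (u - v)
    difference = solve-∀

  d₄-unique : ∀ d₁ s t x y → Solution (d₁ , s , x) → Solution (d₁ , t , y) → N∣ (x - y)
  d₄-unique d₁ s t x y sx sy =
    subst N∣_ (cancel d₁ x y)
      (trace-unique (d₁ + x) (d₁ + y) (linear d₁ s x sx) (linear d₁ t y sy))
    where
    cancel : ∀ d x y → (d + x) - (d + y) ≡ x - y
    cancel = solve-∀

  slice : ℤ → ℕ
  slice d₁ = count (λ p → solution? (d₁ , p)) (cartesianProduct R R)

  fibre : ℤ → ℤ → ℕ
  fibre d₁ d₂ = count (λ d₄ → solution? (d₁ , d₂ , d₄)) R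

  fibre≤1 : ∀ d₁ d₂ → fibre d₁ d₂ ≤ 1
  fibre≤1 d₁ d₂ = count-≤1 (λ d₄ → solution? (d₁ , d₂ , d₄)) residues-incongruent
                    λ {x} {y} sx sy x≢y → x≢y (d₄-unique d₁ d₂ d₂ x y sx sy)

  #solutions≡Σslice : #solutions ≡ sum (map slice R)
  #solutions≡Σslice = count-product solution? R (cartesianProduct R R)

  Admissible : ℤ → ℤ → Set
  Admissible d₁ d₂ = Any (λ d₄ → Solution (d₁ , d₂ , d₄)) R

  admissible? : ∀ d₁ → Decidable (Admissible d₁)
  admissible? d₁ d₂ = any? (λ d₄ → solution? (d₁ , d₂ , d₄)) R

  slice≡#admissible : ∀ d₁ → slice d₁ ≡ count (admissible? d₁) R
  slice≡#admissible d₁ =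
    trans (count-product (λ p → solution? (d₁ , p)) R R)
          (sum-fibres≤1 (λ d₂ d₄ → solution? (d₁ , d₂ , d₄)) R R (fibre≤1 d₁))

  slice≤N : ∀ d₁ → slice d₁ ≤ N
  slice≤N d₁ = subst₂ _≤_ (sym (slice≡#admissible d₁)) residues-length
                          (length-filter (admissible? d₁) R)

  #solutions≤ : ∀ {k} → (∀ d₁ → slice d₁ ≤ k) → #solutions ≤ N * k
  #solutions≤ slice≤k = subst₂ _≤_ (sym #solutions≡Σslice) (cong (_* _) residues-length)
                                  (sum-≤ slice R slice≤k)

  -- Fixing d₁ and one solution (d₁, d₂⁰, d₄⁰), every admissible d₂ is a root of
  -- -h₂ X² + b c₂ X + γ: substitute d₄ ≡ d₄⁰ into the quadric congruence.
  admissible-root : ∀ d₁ d₂⁰ d₄⁰ → Solution (d₁ , d₂⁰ , d₄⁰) → ∀ d₂ → Admissible d₁ d₂ →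
    N∣ quadratic (- h₂) (b · c₂) (d₁ · d₄⁰ · h₂ - b · d₄⁰ · c₁ - b · d₁ · c₄) d₂
  admissible-root d₁ d₂⁰ d₄⁰ sol⁰ d₂ admissible =
    subst N∣_ (substitute d₁ d₂ d₄ d₄⁰ h₂ b c₁ c₂ c₄)
      (∣m∣n⇒∣m-n (quadric d₁ d₂ d₄ sol)
                 (∣m⇒∣m*n (d₁ · h₂ - b · c₁) (d₄-unique d₁ d₂ d₂⁰ d₄ d₄⁰ sol sol⁰)))
    where
    d₄ : ℤ
    d₄ = proj₁ (satisfied admissible)
    sol : Solution (d₁ , d₂ , d₄)
    sol = proj₂ (satisfied admissible)
    substitute : ∀ d₁ t w w⁰ h₂ b c₁ c₂ c₄ →
      ((d₁ · w - t · t) · h₂ - b · (w · c₁ - t · c₂ + d₁ · c₄)) - (w - w⁰) · (d₁ · h₂ - b · c₁)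
      ≡ (- h₂) · t · t + (b · c₂) · t + (d₁ · w⁰ · h₂ - b · w⁰ · c₁ - b · d₁ · c₄)
    substitute = solve-∀

  -- If h₂ or c₂ is nonzero modulo N, that quadratic is not identically zero,
  -- so every slice has at most two elements.
  generic-bound : ¬ N∣ h₂ ⊎ ¬ N∣ c₂ → #solutions ≤ N * 2
  generic-bound nondegenerate = #solutions≤ λ d₁ →
    subst (_≤ 2) (sym (slice≡#admissible d₁)) (#admissible≤2 d₁)
    where
    nonconstant : ∀ γ → ¬ (N∣ (- h₂) × N∣ (b · c₂) × N∣ γ)
    nonconstant γ (N∣-h₂ , N∣bc₂ , _) =
      [ (λ N∤h₂ → N∤h₂ (subst N∣_ (ℤ.neg-involutive h₂) (∣m⇒∣-m N∣-h₂)))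
      , (λ N∤c₂ → N∤c₂ (cancel-unit b c₂ b⊥N N∣bc₂)) ]′ nondegenerate
    #admissible≤2 : ∀ d₁ → count (admissible? d₁) R ≤ 2
    #admissible≤2 d₁ with any? (admissible? d₁) R
    ... | no none = subst (_≤ 2) (sym (count-none (admissible? d₁) none)) z≤n
    ... | yes some = roots≤2 (admissible? d₁) (- h₂) (b · c₂) _ residues-incongruent
                       (nonconstant _) (λ {d₂} → admissible-root d₁ d₂⁰ d₄⁰ sol⁰ d₂)
      where
      d₂⁰ d₄⁰ : ℤ
      d₂⁰ = proj₁ (satisfied some)
      d₄⁰ = proj₁ (satisfied (proj₂ (satisfied some)))
      sol⁰ : Solution (d₁ , d₂⁰ , d₄⁰)
      sol⁰ = proj₂ (satisfied (proj₂ (satisfied some)))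

  cross-term : N∣ h₂ → N∣ c₂ → ∀ d₁ d₂ d₄ → Solution (d₁ , d₂ , d₄) → N∣ (d₄ · c₁ + d₁ · c₄)
  cross-term N∣h₂ N∣c₂ d₁ d₂ d₄ sol = cancel-unit b _ b⊥N
    (subst N∣_ (reduce d₁ d₂ d₄ h₂ b c₁ c₂ c₄)
      (∣m∣n⇒∣m-n (∣m∣n⇒∣m+n (∣n⇒∣m*n (d₁ · d₄ - d₂ · d₂) N∣h₂) (∣n⇒∣m*n (b · d₂) N∣c₂))
                 (quadric d₁ d₂ d₄ sol)))
    where
    reduce : ∀ d₁ d₂ d₄ h₂ b c₁ c₂ c₄ →
      ((d₁ · d₄ - d₂ · d₂) · h₂ + (b · d₂) · c₂)
        - ((d₁ · d₄ - d₂ · d₂) · h₂ - b · (d₄ · c₁ - d₂ · c₂ + d₁ · c₄))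
      ≡ b · (d₄ · c₁ + d₁ · c₄)
    reduce = solve-∀

  -- If moreover c₁ ≢ c₄, the trace and the cross term determine d₁, so only
  -- one slice is non-empty.
  off-diagonal-bound : N∣ h₂ → N∣ c₂ → ¬ N∣ (c₁ - c₄) → #solutions ≤ N
  off-diagonal-bound N∣h₂ N∣c₂ c₁≢c₄ = begin
    #solutions                        ≡⟨ #solutions≡Σslice ⟩
    sum (map slice R)                 ≤⟨ sum-≤-support solvable? slice R slice≤N
                                                       (λ _ → count-none _) ⟩
    count solvable? R * N             ≤⟨ *-monoˡ-≤ N #solvable≤1 ⟩
    1 * N                             ≡⟨ *-identityˡ N ⟩
    N                                 ∎
    where
    open ≤-Reasoning
    Solvable : ℤ → Set
    Solvable d₁ = Any (λ p → Solution (d₁ , p)) (cartesianProduct R R)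
    solvable? : Decidable Solvable
    solvable? d₁ = any? (λ p → solution? (d₁ , p)) (cartesianProduct R R)
    eliminate : ∀ d₁ d₄ e₁ e₄ c₁ c₄ →
      ((d₄ · c₁ + d₁ · c₄) - (e₄ · c₁ + e₁ · c₄)) - c₁ · ((d₁ + d₄) - (e₁ + e₄))
      ≡ (c₁ - c₄) · (e₁ - d₁)
    eliminate = solve-∀
    first-coordinate : ∀ d₁ d₂ d₄ e₁ e₂ e₄ → Solution (d₁ , d₂ , d₄) → Solution (e₁ , e₂ , e₄) →
                       N∣ (e₁ - d₁)
    first-coordinate d₁ d₂ d₄ e₁ e₂ e₄ sd se = cancel-nonzero (c₁ - c₄) (e₁ - d₁) c₁≢c₄
      (subst N∣_ (eliminate d₁ d₄ e₁ e₄ c₁ c₄)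
        (∣m∣n⇒∣m-n (∣m∣n⇒∣m-n (cross-term N∣h₂ N∣c₂ d₁ d₂ d₄ sd)
                              (cross-term N∣h₂ N∣c₂ e₁ e₂ e₄ se))
                   (∣n⇒∣m*n c₁ (trace-unique (d₁ + d₄) (e₁ + e₄)
                                  (linear d₁ d₂ d₄ sd) (linear e₁ e₂ e₄ se)))))
    d₁-unique : ∀ {d₁ e₁} → Solvable d₁ → Solvable e₁ → N∣ (e₁ - d₁)
    d₁-unique {d₁} {e₁} sd se =
      first-coordinate d₁ (proj₁ (proj₁ (satisfied sd))) (proj₂ (proj₁ (satisfied sd)))
                       e₁ (proj₁ (proj₁ (satisfied se))) (proj₂ (proj₁ (satisfied se)))
                       (proj₂ (satisfied sd)) (proj₂ (satisfied se))
    #solvable≤1 : count solvable? R ≤ 1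
    #solvable≤1 = count-≤1 solvable? residues-incongruent
                    λ {x} {y} sx sy x≢y → x≢y (d₁-unique {y} {x} sy sx)

  -- If h₂ ≡ c₂ ≡ 0 and c₁ ≡ c₄ (so c₁ ≢ 0 by the discriminant hypothesis),
  -- the cross term is c₁ (d₁ + d₄), forcing d₁ + d₄ ≡ 0 and hence h₁ ≡ 0.
  no-solutions : ¬ (+ 4 · c₁ · c₄ - c₂ · c₂ ≡ + 0 [mod N ]) →
                 N∣ h₂ → N∣ c₂ → N∣ (c₁ - c₄) → ¬ N∣ h₁ → #solutions ≡ 0
  no-solutions disc≢0 N∣h₂ N∣c₂ c₁≡c₄ N∤h₁ =
    count-none solution? {triples N}
      λ some → no-solution (proj₁ (satisfied some)) (proj₂ (satisfied some))
    where
    N∤c₁ : ¬ N∣ c₁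
    N∤c₁ N∣c₁ = disc≢0 (N∣⇒≡0 (∣m∣n⇒∣m-n (∣m⇒∣m*n c₄ (∣n⇒∣m*n (+ 4) N∣c₁)) (∣n⇒∣m*n c₂ N∣c₂)))
    diagonal : ∀ d₁ d₄ c₁ c₄ → (d₄ · c₁ + d₁ · c₄) + d₁ · (c₁ - c₄) ≡ c₁ · (d₁ + d₄)
    diagonal = solve-∀
    no-solution : ∀ t → Solution t → ⊥
    no-solution (d₁ , d₂ , d₄) sol =
      [ N∤c₁
      , (λ N∣trace → N∤h₁ (∣m+n∣n⇒∣m (linear d₁ d₂ d₄ sol) (∣m⇒∣-m (∣n⇒∣m*n a N∣trace)))) ]′
        (euclid c₁ (d₁ + d₄) (subst N∣_ (diagonal d₁ d₄ c₁ c₄)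
          (∣m∣n⇒∣m+n (cross-term N∣h₂ N∣c₂ d₁ d₂ d₄ sol) (∣n⇒∣m*n d₁ c₁≡c₄))))

  anti-diagonal-solution : N∣ h₁ → N∣ h₂ → N∣ c₂ → N∣ (c₁ - c₄) →
    ∀ d₁ d₂ d₄ → N∣ (d₁ + d₄) → ¬ (d₁ · d₄ - d₂ · d₂ ≡ + 0 [mod N ]) →
    Solution (d₁ , d₂ , d₄)
  anti-diagonal-solution N∣h₁ N∣h₂ N∣c₂ c₁≡c₄ d₁ d₂ d₄ N∣trace det≢0 =
    N∣⇒mod {h₁} (∣m∣n⇒∣m-n N∣h₁ (∣n⇒∣m*n a N∣trace)) ,
    N∣⇒mod {(d₁ · d₄ - d₂ · d₂) · h₂} (subst N∣_ (expand d₁ d₂ d₄ h₂ b c₁ c₂ c₄)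
      (∣m∣n⇒∣m+n (∣m∣n⇒∣m-n (∣m∣n⇒∣m+n (∣n⇒∣m*n (d₁ · d₄ - d₂ · d₂) N∣h₂)
                                        (∣n⇒∣m*n (b · d₂) N∣c₂))
                            (∣n⇒∣m*n (b · c₁) N∣trace))
                 (∣n⇒∣m*n (b · d₁) c₁≡c₄))) ,
    det≢0
    where
    expand : ∀ d₁ d₂ d₄ h₂ b c₁ c₂ c₄ →
      (d₁ · d₄ - d₂ · d₂) · h₂ + (b · d₂) · c₂ - (b · c₁) · (d₁ + d₄) + (b · d₁) · (c₁ - c₄)
      ≡ (d₁ · d₄ - d₂ · d₂) · h₂ - b · (d₄ · c₁ - d₂ · c₂ + d₁ · c₄)
    expand = solve-∀

  -- Hence, with r ≡ -d₁ in R, d₂ is admissible for d₁ unless the determinant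
  -- d₁ r - d₂² ≡ -(d₁² + d₂²) vanishes, which happens for at most two d₂.
  #inadmissible≤2 : N∣ h₁ → N∣ h₂ → N∣ c₂ → N∣ (c₁ - c₄) →
                    ∀ d₁ → count (¬? ∘ admissible? d₁) R ≤ 2
  #inadmissible≤2 N∣h₁ N∣h₂ N∣c₂ c₁≡c₄ d₁ =
    roots≤2 (¬? ∘ admissible? d₁) (- + 1) (+ 0) (- (d₁ · d₁)) residues-incongruent
      (λ (N∣-1 , _) → N∤-1 N∣-1)
      (λ {d₂} inadmissible → subst N∣_ (complete d₁ d₂ r)
         (∣m∣n⇒∣m-n (singular d₂ inadmissible) (∣n⇒∣m*n d₁ N∣d₁+r)))
    where
    r : ℤ
    r = proj₁ (residue-of (- d₁))
    r∈R : r ∈ R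
    r∈R = proj₁ (proj₂ (residue-of (- d₁)))
    negate : ∀ r d → r - - d ≡ d + r
    negate = solve-∀
    N∣d₁+r : N∣ (d₁ + r)
    N∣d₁+r = subst N∣_ (negate r d₁) (proj₂ (proj₂ (residue-of (- d₁))))
    singular : ∀ d₂ → ¬ Admissible d₁ d₂ → N∣ (d₁ · r - d₂ · d₂)
    singular d₂ inadmissible = ≡0⇒N∣ (decidable-stable (d₁ · r - d₂ · d₂ ≡? + 0 [mod N ])
      λ det≢0 → inadmissible
        (lose r∈R (anti-diagonal-solution N∣h₁ N∣h₂ N∣c₂ c₁≡c₄ d₁ d₂ r N∣d₁+r det≢0)))
    complete : ∀ d₁ d₂ r → (d₁ · r - d₂ · d₂) - d₁ · (d₁ + r)
                           ≡ (- + 1) · d₂ · d₂ + + 0 · d₂ + - (d₁ · d₁)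
    complete = solve-∀

  main-bounds : N∣ h₁ → N∣ h₂ → N∣ c₂ → N∣ (c₁ - c₄) →
                #solutions ≤ N * N × N * N ≤ #solutions ℕ.+ N * 2
  main-bounds N∣h₁ N∣h₂ N∣c₂ c₁≡c₄ = #solutions≤ slice≤N , lower
    where
    slice≥ : ∀ d₁ → N ≤ slice d₁ ℕ.+ 2
    slice≥ d₁ = subst₂ _≤_ (trans (count-split (admissible? d₁) R) residues-length)
                           (cong (ℕ._+ 2) (sym (slice≡#admissible d₁)))
                           (+-monoʳ-≤ _ (#inadmissible≤2 N∣h₁ N∣h₂ N∣c₂ c₁≡c₄ d₁))
    lower : N * N ≤ #solutions ℕ.+ N * 2
    lower = subst₂ (λ n s → n * N ≤ s ℕ.+ n * 2) residues-length (sym #solutions≡Σslice)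
                   (sum-≥ slice R slice≥)

  small-count : ¬ (+ 4 · c₁ · c₄ - c₂ · c₂ ≡ + 0 [mod N ]) →
                ¬ (N∣ h₁ × N∣ h₂ × N∣ c₂ × N∣ (c₁ - c₄)) → #solutions ≤ N * 2
  small-count disc≢0 not-main with + N ∣? h₂ | + N ∣? c₂ | + N ∣? (c₁ - c₄)
  ... | no N∤h₂  | _        | _         = generic-bound (inj₁ N∤h₂)
  ... | yes _    | no N∤c₂  | _         = generic-bound (inj₂ N∤c₂)
  ... | yes N∣h₂ | yes N∣c₂ | no c₁≢c₄  =
    ≤-trans (off-diagonal-bound N∣h₂ N∣c₂ c₁≢c₄) (m≤m*n N 2)
  ... | yes N∣h₂ | yes N∣c₂ | yes c₁≡c₄ =
    subst (_≤ N * 2) (sym (no-solutions disc≢0 N∣h₂ N∣c₂ c₁≡c₄ N∤h₁)) z≤n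
    where
    N∤h₁ : ¬ N∣ h₁
    N∤h₁ N∣h₁ = not-main (N∣h₁ , N∣h₂ , N∣c₂ , c₁≡c₄)

  within-2N : ∀ {m n} → m ≤ n ℕ.+ N * 2 → n ≤ m ℕ.+ N * 2 → ∣ + m - + n ∣ ≤ 2 * N
  within-2N {m} {n} m≤ n≤ =
    subst (∣ + m - + n ∣ ≤_) (*-comm N 2) (distance-≤ m n (N * 2) m≤ n≤)

  estimate : ¬ (+ 4 · c₁ · c₄ - c₂ · c₂ ≡ + 0 [mod N ]) →
    ∣ + #solutions - + (δ ((h₁ ≡? + 0 [mod N ]) ×-dec (h₂ ≡? + 0 [mod N ]))
                        * δ ((c₁ ≡? c₄ [mod N ]) ×-dec (c₂ ≡? + 0 [mod N ])) * N ^ 2) ∣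
      ≤ 2 * N
  estimate disc≢0 with (h₁ ≡? + 0 [mod N ]) ×-dec (h₂ ≡? + 0 [mod N ])
                     | (c₁ ≡? c₄ [mod N ]) ×-dec (c₂ ≡? + 0 [mod N ])
  ... | no h-fails | _ =
    within-2N (small-count disc≢0 λ (N∣h₁ , N∣h₂ , _) → h-fails (N∣⇒≡0 N∣h₁ , N∣⇒≡0 N∣h₂)) z≤n
  ... | yes _ | no c-fails =
    within-2N (small-count disc≢0 λ (_ , _ , N∣c₂ , c₁≡c₄) →
                 c-fails (N∣⇒mod {c₁} c₁≡c₄ , N∣⇒≡0 N∣c₂)) z≤n
  ... | yes (h₁≡0 , h₂≡0) | yes (c₁≡c₄ , c₂≡0) =
    subst (λ M → ∣ + #solutions - + M ∣ ≤ 2 * N) N²≡main-term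
          (within-2N (≤-trans (proj₁ bounds) (m≤m+n _ _)) (proj₂ bounds))
    where
    bounds : #solutions ≤ N * N × N * N ≤ #solutions ℕ.+ N * 2
    bounds = main-bounds (≡0⇒N∣ h₁≡0) (≡0⇒N∣ h₂≡0) (≡0⇒N∣ c₂≡0) (mod⇒N∣ {c₁} c₁≡c₄)
    N²≡main-term : N * N ≡ 1 * 1 * N ^ 2
    N²≡main-term = sym (trans (*-identityˡ (N ^ 2)) (cong (N *_) (*-identityʳ N)))

lemma12 : ∃[ C ] (∀ (N : ℕ) → Prime N → N % 4 ≡ 3 →
    ∀ (h₁ h₂ c₁ c₂ c₄ : ℤ) →
    ¬ ((((+ 4) ℤ.* c₁) ℤ.* c₄) - (c₂ ℤ.* c₂) ≡ + 0 [mod N ]) →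
    ∀ (a b : ℤ) → Coprime a (+ N) → Coprime b (+ N) →
    ∣ (+ L N a b c₁ c₂ c₄ h₁ h₂)
    - (+ (δ ((h₁ ≡? + 0 [mod N ]) ×-dec (h₂ ≡? + 0 [mod N ]))
    ℕ.* δ ((c₁ ≡? c₄ [mod N ]) ×-dec (c₂ ≡? + 0 [mod N ]))
    ℕ.* (N ^ 2))) ∣
    ≤ C ℕ.* N)
lemma12 = 2 , λ N N-prime _ h₁ h₂ c₁ c₂ c₄ disc≢0 a b a⊥N b⊥N →
  TripleCount.estimate N N-prime a b c₁ c₂ c₄ h₁ h₂ a⊥N b⊥N disc≢0
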